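{- For all partitions $\lambda,\mu$ of $n$ with $\lambda\neq\mu$, the map $\theta_{\lambda,\mu}$ defined in the context is a sign-reversing involution on $E_{\lambda,\mu}\setminus D_{\lambda,\mu}$; that is, it maps $E_{\lambda,\mu}\setminus D_{\lambda,\mu}$ to itself, $\theta_{\lambda,\mu}\circ\theta_{\lambda,\mu}$ is the identity, and if $\theta_{\lambda,\mu}(V,U)=(V',U')$ then $\operatorname{sgn}(V')=-\operatorname{sgn}(V)$.
   Context: A composition is a finite sequence of positive integers; $\operatorname{dec}(\alpha)$ is the partition obtained by sorting $\alpha$ into weakly decreasing order. For a composition $\gamma=(\gamma_1,\dots,\gamma_\ell)$, its diagram has cells $(i,j)$, $1\le i\le\ell$, $1\le j\le\gamma_i$ (row $i$ from the top). An immaculate tableau of shape $\gamma$ is a filling by positive integers with rows weakly increasing left to right and first column strictly increasing top to bottom; its content counts entries of each value. A semistandard Young tableau (SSYT) is an immaculate tableau of partition shape whose columns are also strictly increasing top to bottom. For an integer sequence $a$, $\operatorname{fl}(a)$ deletes its zeros. Permutations are in one-line notation, $s_i=(i,i+1)$, products compose right to left ($(\sigma\tau)(i)=\sigma(\tau(i))$). Tunnel hook coverings (THCs), introduced by Allen and Mason; only these facts are needed: for a composition $\gamma$ of length $\ell$, each THC $T$ of shape $\gamma$ has a permutation $\operatorname{perm}(T)\in S_\ell$, and $T\mapsto\operatorname{perm}(T)$ is a bijection from THCs of shape $\gamma$ onto $S_\ell$; $\operatorname{sgn}(T)=\operatorname{sgn}(\operatorname{perm}(T))$; $\Delta_i(T)=\gamma_i+\sigma_i-i$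 for $\sigma=\operatorname{perm}(T)$; the content of $T$ is $\operatorname{fl}(\Delta(T))$. For partitions $\lambda,\mu$ of $n$: $D_{\lambda,\mu}$ is the set of pairs $(T,S)$ where $T$ is a THC whose content $\alpha$ satisfies $\operatorname{dec}(\alpha)=\lambda$ and $S$ is an SSYT of shape $\operatorname{sh}(T)$ and content $\mu$; $E_{\lambda,\mu}$ is defined identically except that $S$ is only required to be an immaculate tableau of shape $\operatorname{sh}(T)$ and content $\mu$. For $(V,U)\in E_{\lambda,\mu}$, a cell $(i,j)$ of $U$ is bad if $i\ge2$ and either $(i-1,j)$ is not a cell of $U$ or $U(i-1,j)\ge U(i,j)$. The map $\theta_{\lambda,\mu}$: for $(V,U)\in E_{\lambda,\mu}\setminus D_{\lambda,\mu}$, let $i$ be the leftmost column of $U$ containing a bad cell and $t$ the largest row index such that $(t,i)$ is bad. Swap the cell sets $P=\{(t,j)\in U: j>i\}$ and $Q=\{(t-1,j)\in U: j\ge i\}$ to form $U'$: $U'(t,j)=U(t-1,j-1)$ for $j>i$ and $U'(t-1,j)=U(t,j+1)$ for $j\ge i$ (whenever the right side is defined), and $U'(x,y)=U(x,y)$ for all other cells. Let $V'$ be the THC of shape $\operatorname{sh}(U')$ with $\operatorname{perm}(V')=\operatorname{perm}(V)s_{t-1}$, and set $\theta_{\lambda,\mu}(V,U)=(V',U')$. -}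

module Defs where

open import Data.Bool using (Bool; true; false; _∧_; _∨_; not; if_then_else_)
open import Data.Nat as ℕ using (ℕ; zero; suc; _≤_; _<_; _≥_; _∸_)
open import Data.Nat.Properties as ℕP using ()
open import Data.Integer as ℤ using (ℤ; +_; 0ℤ; 1ℤ; -1ℤ)
open import Data.Integer.Properties as ℤP using ()
open import Data.Nat.ListAction using (sum)
open import Data.List using (List; []; _∷_; length; map; filterᵇ; concat; take; drop; upTo; reverse; filter; mapMaybe; head; last; any)
open import Data.List.Relation.Unary.All using (All)
open import Data.List.Relation.Unary.Linked using (Linked)
open import Data.List.Relation.Binary.Permutation.Propositional using (_↭_)
open import Data.Maybe using (Maybe; just; nothing)
open import Data.Product using (_×_; _,_; proj₁; proj₂)
open import Relation.Nullary using (¬_; ¬?)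
open import Relation.Binary.PropositionalEquality using (_≡_)
import Data.List.Sort

-- A filling of a diagram is a list of rows (List (List ℕ)); row i of the
-- paper (1-based, from the top) is the (i-1)-th element of the list, and
-- cell (i,j) of the paper is entry (i-1) (j-1) below.  A permutation of
-- S_ℓ is given in one-line notation as a list of length ℓ which is a
-- rearrangement of [1,…,ℓ].

IsPartition : ℕ → List ℕ → Set
IsPartition n la = Linked _≥_ la × All (λ x → 1 ≤ x) la × sum la ≡ n

IsComposition : List ℕ → Set
IsComposition γ = All (λ x → 1 ≤ x) γ

module SortZ = Data.List.Sort ℤP.≤-decTotalOrder

dec : List ℤ → List ℤ
dec α = reverse (SortZ.sort α)

fl : List ℤ → List ℤ
fl = filter (λ x → ¬? (x ℤ.≟ 0ℤ))

IsPermOf : ℕ → List ℕ → Set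
IsPermOf ℓ σ = σ ↭ map suc (upTo ℓ)

inversions : List ℕ → ℕ
inversions [] = 0
inversions (x ∷ xs) = length (filterᵇ (λ y → y ℕ.<ᵇ x) xs) ℕ.+ inversions xs

sgn : List ℕ → ℤ
sgn σ = -1ℤ ℤ.^ inversions σ

ΔFrom : ℕ → List ℕ → List ℕ → List ℤ
ΔFrom k (g ∷ γ) (s ∷ σ) = ((+ g) ℤ.+ (+ s) ℤ.- (+ k)) ∷ ΔFrom (suc k) γ σ
ΔFrom k _ _ = []

-- Δ(T) for the THC T of shape γ with perm(T) = σ
Δ : List ℕ → List ℕ → List ℤ
Δ γ σ = ΔFrom 1 γ σ

-- content of the THC of shape γ with permutation σ
thcContent : List ℕ → List ℕ → List ℤ
thcContent γ σ = fl (Δ γ σ)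

shape : List (List ℕ) → List ℕ
shape U = map length U

lookupM : {A : Set} → List A → ℕ → Maybe A
lookupM [] _ = nothing
lookupM (x ∷ xs) zero = just x
lookupM (x ∷ xs) (suc k) = lookupM xs k

entry : List (List ℕ) → ℕ → ℕ → Maybe ℕ
entry U r c with lookupM U r
... | nothing = nothing
... | just row = lookupM row c

IsImmaculate : List (List ℕ) → Set
IsImmaculate U =
  All (All (λ x → 1 ≤ x)) U × All (Linked _≤_) U × Linked _<_ (mapMaybe head U)

IsSSYT : List (List ℕ) → Set
IsSSYT U =
  IsImmaculate U × Linked _≥_ (shape U) ×
  (∀ r c x y → entry U r c ≡ just x → entry U (suc r) c ≡ just y → x < y)

count : ℕ → List (List ℕ) → ℕ
count k U = length (filterᵇ (λ x → x ℕ.≡ᵇ k) (concat U))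

-- μ_k (1-based), 0 if k = 0 or k > length μ
part : List ℕ → ℕ → ℕ
part μ zero = 0
part μ (suc k) with lookupM μ k
... | nothing = 0
... | just m = m

HasContent : List ℕ → List (List ℕ) → Set
HasContent μ U = ∀ k → count k U ≡ part μ k

-- An element (V,U) is represented by (U , σ) where
-- σ = perm(V) in one-line notation; V is the unique THC of shape sh(U)
-- with perm(V) = σ (THCs of shape γ are in bijection with S_ℓ via perm).

Pair : Set
Pair = List (List ℕ) × List ℕ

IsTHCpart : List ℕ → Pair → Set
IsTHCpart la (U , σ) =
  IsComposition (shape U) × IsPermOf (length U) σ ×
  dec (thcContent (shape U) σ) ≡ map +_ la

InE : List ℕ → List ℕ → Pair → Set
InE la mu (U , σ) = IsTHCpart la (U , σ) × IsImmaculate U × HasContent mu U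

InD : List ℕ → List ℕ → Pair → Set
InD la mu (U , σ) = IsTHCpart la (U , σ) × IsSSYT U × HasContent mu U

InEminusD : List ℕ → List ℕ → Pair → Set
InEminusD la mu p = InE la mu p × ¬ InD la mu p

isBad : List (List ℕ) → ℕ → ℕ → Bool
isBad U zero c = false
isBad U (suc r) c with entry U (suc r) c | entry U r c
... | nothing | _ = false
... | just x | nothing = true
... | just x | just y = x ℕ.≤ᵇ y

maxRowLength : List (List ℕ) → ℕ
maxRowLength [] = 0
maxRowLength (row ∷ U) = length row ℕ.⊔ maxRowLength U

badRows : List (List ℕ) → ℕ → List ℕ
badRows U c = filterᵇ (λ r → isBad U r c) (upTo (length U))

findFrom : List (List ℕ) → List ℕ → Maybe (ℕ × ℕ)
findFrom U [] = nothing
findFrom U (c ∷ cs) with last (badRows U c)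
... | just r = just (c , r)
... | nothing = findFrom U cs

findBad : List (List ℕ) → Maybe (ℕ × ℕ)
findBad U = findFrom U (upTo (maxRowLength U))

adj : {A : Set} → ℕ → (A → A → A × A) → List A → List A
adj zero f (x ∷ y ∷ xs) = proj₁ (f x y) ∷ proj₂ (f x y) ∷ xs
adj zero f xs = xs
adj (suc k) f [] = []
adj (suc k) f (x ∷ xs) = x ∷ adj k f xs

-- the cell swap: with paper indices i = c+1, t = r+1 (rows r-1, r are the
-- paper's rows t-1, t):
--   new row t-1 = (U(t-1,1..i-1)) ++ (U(t,i+1..))
--   new row t   = (U(t,1..i))     ++ (U(t-1,i..))
swapRows : ℕ → List ℕ → List ℕ → List ℕ × List ℕ
swapRows c above below =
  (take c above Data.List.++ drop (suc c) below) ,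
  (take (suc c) below Data.List.++ drop c above)

-- θ; identity when there is no bad cell (irrelevant: then (V,U) ∈ D)
θ : Pair → Pair
θ (U , σ) with findBad U
... | nothing = (U , σ)
... | just (c , zero) = (U , σ)
... | just (c , suc r) =
  (adj r (swapRows c) U , adj r (λ a b → (b , a)) σ)

{-# OPTIONS --safe #-}

-- θ acts at the lowest bad cell (t, i) of the leftmost column containing bad cells. The
-- exchange keeps (t, i) bad and changes no cell left of column i and no cell of column i
-- from row t down, so θ acts at (t, i) again and undoes the exchange. The good cell left
-- of (t, i) and the badness of (t, i) keep both new rows weakly increasing; the first
-- column has no bad cells, so it is untouched; entries are only moved around. The new row
-- lengths γ_t − 1 and γ_{t−1} + 1 are exactly those for which, with perm(V) s_{t−1}, the
-- entries Δ_{t−1} and Δ_t trade places: the THC content is permuted and the sign flips,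
-- the two exchanged entries of perm(V) being distinct.
module Submission where

open import Algebra.Properties.CommutativeSemigroup using (x∙yz≈y∙xz)
open import Data.Bool using (Bool; true; false; T; T?; if_then_else_)
open import Data.Bool.Properties using (T-≡; ¬-not; not-¬)
open import Data.Empty using (⊥-elim)
open import Data.Integer as ℤ using (-_; +_)
import Data.Integer.Properties as ℤ
open import Data.Integer.Solver using (module +-*-Solver)
open import Data.List
  using ( List; []; _∷_; [_]; _++_; _∷ʳ_; length; map; concat; take; drop; head; last
        ; mapMaybe; catMaybes; filterᵇ; upTo; reverse)
open import Data.List.Properties
  using ( ++-assoc; ++-identityʳ; map-++; concat-++; length-++; length-map; length-take; length-drop
        ; length-upTo; take++drop≡id; upTo-∷ʳ; filter-++; filter-accept; filter-reject)
open import Data.List.Relation.Binary.Permutation.Propositional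
  using (_↭_; refl; prep; swap; ↭-sym; ↭-trans; ↭⇒↭ₛ; module PermutationReasoning)
open import Data.List.Relation.Binary.Permutation.Propositional.Properties
  using (++⁺ˡ; ++⁺ʳ; ++-comm; shifts; filter-↭; ↭-length)
import Data.List.Relation.Binary.Permutation.Setoid.Properties as Perm
open import Data.List.Relation.Binary.Pointwise using (Pointwise-≡⇒≡)
open import Data.List.Relation.Unary.All using (All; []; _∷_)
open import Data.List.Relation.Unary.AllPairs using ([]; _∷_)
import Data.List.Relation.Unary.All.Properties as All
open import Data.List.Relation.Unary.Linked using (Linked; []; [-]; _∷_)
import Data.List.Relation.Unary.Linked.Properties as Linked
import Data.List.Relation.Unary.Sorted.TotalOrder.Properties as Sorted
open import Data.List.Relation.Unary.Unique.Propositional using (Unique)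
import Data.List.Relation.Unary.Unique.Propositional.Properties as Unique
open import Data.Maybe using (Maybe; just; nothing; _>>=_; _<∣>_)
import Data.Maybe as Maybe
open import Data.Maybe.Relation.Binary.Connected using (Connected; just; just-nothing)
open import Data.Nat using (ℕ; zero; suc; _+_; _∸_; _≤_; _<_; _≥_; _≤ᵇ_; _<ᵇ_; z≤n; s≤s)
open import Data.Nat.Properties
open import Data.Product using (_×_; _,_; proj₁; proj₂; ∃; ∃₂; uncurry)
open import Data.Sum using (inj₁; inj₂)
open import Function using (_∘_; Equivalence)
open import Relation.Binary.Definitions using (tri<; tri≈; tri>)
open import Relation.Binary.PropositionalEquality hiding ([_])
open import Relation.Binary.PropositionalEquality.Properties using (setoid)
open import Relation.Nullary using (yes; no)

open import Defs

private variable
  A B : Set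

lookupM-just⇒< : ∀ (xs : List A) {i x} → lookupM xs i ≡ just x → i < length xs
lookupM-just⇒< (_ ∷ _)  {zero}  _  = s≤s z≤n
lookupM-just⇒< (_ ∷ xs) {suc i} eq = s≤s (lookupM-just⇒< xs eq)

lookupM-< : ∀ (xs : List A) {i} → i < length xs → ∃ λ x → lookupM xs i ≡ just x
lookupM-< (x ∷ _)  {zero}  _         = x , refl
lookupM-< (_ ∷ xs) {suc i} (s≤s i<n) = lookupM-< xs i<n

lookupM-nothing⇒≥ : ∀ (xs : List A) {i} → lookupM xs i ≡ nothing → length xs ≤ i
lookupM-nothing⇒≥ []       _          = z≤n
lookupM-nothing⇒≥ (_ ∷ xs) {suc i} eq = s≤s (lookupM-nothing⇒≥ xs eq)

lookupM-pred : ∀ (xs : List A) {i y} → lookupM xs (suc i) ≡ just y → ∃ λ x → lookupM xs i ≡ just x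
lookupM-pred xs eq = lookupM-< xs (<-trans (n<1+n _) (lookupM-just⇒< xs eq))

lookupM-map : ∀ (f : A → B) xs {i} → lookupM (map f xs) i ≡ Maybe.map f (lookupM xs i)
lookupM-map f []               = refl
lookupM-map f (_ ∷ _)  {zero}  = refl
lookupM-map f (_ ∷ xs) {suc i} = lookupM-map f xs

lookupM-take-++ : ∀ {n} (xs : List A) {ys i} → i < n → n ≤ length xs →
  lookupM (take n xs ++ ys) i ≡ lookupM xs i
lookupM-take-++ (_ ∷ _)  {i = zero}  (s≤s _)   (s≤s _)   = refl
lookupM-take-++ (_ ∷ xs) {i = suc i} (s≤s i<n) (s≤s n≤l) = lookupM-take-++ xs i<n n≤l

lookupM-take-++-length : ∀ {n} (xs : List A) {ys} → n ≤ length xs →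
  lookupM (take n xs ++ ys) n ≡ head ys
lookupM-take-++-length {n = zero}  _        {[]}    _         = refl
lookupM-take-++-length {n = zero}  _        {_ ∷ _} _         = refl
lookupM-take-++-length {n = suc n} (_ ∷ xs)         (s≤s n≤l) = lookupM-take-++-length xs n≤l

lookupM-mid₀ : ∀ (xs : List A) {x ys} → lookupM (xs ++ x ∷ ys) (length xs) ≡ just x
lookupM-mid₀ []       = refl
lookupM-mid₀ (_ ∷ xs) = lookupM-mid₀ xs

lookupM-mid₁ : ∀ (xs : List A) {x y ys} → lookupM (xs ++ x ∷ y ∷ ys) (suc (length xs)) ≡ just y
lookupM-mid₁ []       = refl
lookupM-mid₁ (_ ∷ xs) = lookupM-mid₁ xs

lookupM-mid-≢ : ∀ (xs : List A) {x y x′ y′ ys i} → i ≢ length xs → i ≢ suc (length xs) →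
  lookupM (xs ++ x′ ∷ y′ ∷ ys) i ≡ lookupM (xs ++ x ∷ y ∷ ys) i
lookupM-mid-≢ []       {i = zero}        i≢0 _   = ⊥-elim (i≢0 refl)
lookupM-mid-≢ []       {i = suc zero}    _   i≢1 = ⊥-elim (i≢1 refl)
lookupM-mid-≢ []       {i = suc (suc i)} _   _   = refl
lookupM-mid-≢ (_ ∷ xs) {i = zero}        _   _   = refl
lookupM-mid-≢ (_ ∷ xs) {i = suc i}       i≢  i≢′ = lookupM-mid-≢ xs (i≢ ∘ cong suc) (i≢′ ∘ cong suc)

length-take-≤ : ∀ {n} (xs : List A) → n ≤ length xs → length (take n xs) ≡ n
length-take-≤ {n = n} xs n≤l = trans (length-take n xs) (m≤n⇒m⊓n≡m n≤l)

take-++ : ∀ {n} (xs : List A) {ys} → length xs ≡ n → take n (xs ++ ys) ≡ xs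
take-++ []       refl = refl
take-++ (x ∷ xs) refl = cong (x ∷_) (take-++ xs refl)

drop-++ : ∀ {n} (xs : List A) {ys} → length xs ≡ n → drop n (xs ++ ys) ≡ ys
drop-++ []       refl = refl
drop-++ (_ ∷ xs) refl = drop-++ xs refl

head-drop : ∀ n (xs : List A) → head (drop n xs) ≡ lookupM xs n
head-drop zero    []       = refl
head-drop zero    (_ ∷ _)  = refl
head-drop (suc n) []       = refl
head-drop (suc n) (_ ∷ xs) = head-drop n xs

last-take : ∀ n (xs : List A) → n < length xs → last (take (suc n) xs) ≡ lookupM xs n
last-take zero    (_ ∷ [])     _         = refl
last-take zero    (_ ∷ _ ∷ _)  _         = refl
last-take (suc n) (_ ∷ y ∷ xs) (s≤s n<l) = last-take n (y ∷ xs) n<l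

head-take-++ : ∀ n (xs : List A) {ys} → 0 < length xs → head (take (suc n) xs ++ ys) ≡ head xs
head-take-++ n (_ ∷ _) _ = refl

last-∷ʳ : ∀ (xs : List A) x → last (xs ∷ʳ x) ≡ just x
last-∷ʳ []           _ = refl
last-∷ʳ (_ ∷ [])     _ = refl
last-∷ʳ (_ ∷ y ∷ xs) x = last-∷ʳ (y ∷ xs) x

map-mid : ∀ (f : A → B) xs {x y x′ y′ ys} → f x′ ≡ f x → f y′ ≡ f y →
  map f (xs ++ x′ ∷ y′ ∷ ys) ≡ map f (xs ++ x ∷ y ∷ ys)
map-mid f []       {ys = ys} fx fy = cong₂ (λ u v → u ∷ v ∷ map f ys) fx fy
map-mid f (z ∷ xs)           fx fy = cong (f z ∷_) (map-mid f xs fx fy)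

All-mid⁻ : ∀ {P : A → Set} xs {x y ys} → All P (xs ++ x ∷ y ∷ ys) → P x × P y
All-mid⁻ []       (px ∷ py ∷ _) = px , py
All-mid⁻ (_ ∷ xs) (_ ∷ ps)      = All-mid⁻ xs ps

All-mid : ∀ {P : A → Set} xs {x y x′ y′ ys} → All P (xs ++ x ∷ y ∷ ys) → P x′ → P y′ →
  All P (xs ++ x′ ∷ y′ ∷ ys)
All-mid []       (_ ∷ _ ∷ ps) px′ py′ = px′ ∷ py′ ∷ ps
All-mid (_ ∷ xs) (p ∷ ps)     px′ py′ = p ∷ All-mid xs ps px′ py′

Linked-lookupM : ∀ {R : A → A → Set} {xs i x y} → Linked R xs →
  lookupM xs i ≡ just x → lookupM xs (suc i) ≡ just y → R x y
Linked-lookupM {i = zero}  (Rxy ∷ _) refl refl = Rxy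
Linked-lookupM {i = suc i} (_ ∷ Rxs) xᵢ   xᵢ₊₁ = Linked-lookupM Rxs xᵢ xᵢ₊₁
Linked-lookupM {i = suc i} [-]       ()   _

Linked-fromLookupM : ∀ {R : A → A → Set} xs →
  (∀ {i x y} → lookupM xs i ≡ just x → lookupM xs (suc i) ≡ just y → R x y) → Linked R xs
Linked-fromLookupM []           _ = []
Linked-fromLookupM (_ ∷ [])     _ = [-]
Linked-fromLookupM (x ∷ y ∷ xs) R =
  R {i = 0} refl refl ∷ Linked-fromLookupM (y ∷ xs) (λ {i} → R {i = suc i})

Linked-take : ∀ {R : A → A → Set} n {xs} → Linked R xs → Linked R (take n xs)
Linked-take zero          _          = []
Linked-take (suc n)       []         = []
Linked-take (suc zero)    [-]        = [-]
Linked-take (suc (suc n)) [-]        = [-]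
Linked-take (suc zero)    (_ ∷ _)    = [-]
Linked-take (suc (suc n)) (Rxy ∷ Rs) = Rxy ∷ Linked-take (suc n) Rs

Linked-drop : ∀ {R : A → A → Set} n {xs} → Linked R xs → Linked R (drop n xs)
Linked-drop zero          Rs       = Rs
Linked-drop (suc n)       []       = []
Linked-drop (suc zero)    [-]      = []
Linked-drop (suc (suc n)) [-]      = []
Linked-drop (suc n)       (_ ∷ Rs) = Linked-drop n Rs

Connected-just : ∀ {R : A → A → Set} {x} m → (∀ {y} → m ≡ just y → R x y) → Connected R (just x) m
Connected-just nothing  _ = just-nothing
Connected-just (just y) R = just (R refl)

adj-++ : ∀ (xs : List A) {n x y ys} (f : A → A → A × A) → length xs ≡ n →
  adj n f (xs ++ x ∷ y ∷ ys) ≡ xs ++ proj₁ (f x y) ∷ proj₂ (f x y) ∷ ys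
adj-++ []       f refl = refl
adj-++ (z ∷ xs) f refl = cong (z ∷_) (adj-++ xs f refl)

data AdjacentPairAt {A : Set} (r : ℕ) : List A → Set where
  pairAt : ∀ pre x y post → length pre ≡ r → AdjacentPairAt r (pre ++ x ∷ y ∷ post)

adjacentPairAt : ∀ r (xs : List A) → suc r < length xs → AdjacentPairAt r xs
adjacentPairAt zero    (x ∷ y ∷ xs) _ = pairAt [] x y xs refl
adjacentPairAt zero    (x ∷ [])     (s≤s ())
adjacentPairAt (suc r) (x ∷ xs)     (s≤s r<l) with adjacentPairAt r xs r<l
... | pairAt pre y z post refl = pairAt (x ∷ pre) y z post refl

swap-mid-↭ : ∀ (xs : List A) {x y ys} → xs ++ y ∷ x ∷ ys ↭ xs ++ x ∷ y ∷ ys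
swap-mid-↭ xs {x} {y} = ++⁺ˡ xs (swap y x refl)

concat-mid-↭ : ∀ (xss : List (List A)) {x y x′ y′ yss} → x′ ++ y′ ↭ x ++ y →
  concat (xss ++ x′ ∷ y′ ∷ yss) ↭ concat (xss ++ x ∷ y ∷ yss)
concat-mid-↭ xss {x} {y} {x′} {y′} {yss} p = begin
  concat (xss ++ x′ ∷ y′ ∷ yss)           ≡⟨ concat-++ xss _ ⟨
  concat xss ++ x′ ++ y′ ++ concat yss    ≡⟨ cong (concat xss ++_) (++-assoc x′ y′ _) ⟨
  concat xss ++ (x′ ++ y′) ++ concat yss  ↭⟨ ++⁺ˡ (concat xss) (++⁺ʳ (concat yss) p) ⟩
  concat xss ++ (x ++ y) ++ concat yss    ≡⟨ cong (concat xss ++_) (++-assoc x y _) ⟩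
  concat xss ++ x ++ y ++ concat yss      ≡⟨ concat-++ xss _ ⟩
  concat (xss ++ x ∷ y ∷ yss)             ∎
  where open PermutationReasoning

-- Permutations and signs

dec-↭ : ∀ {xs ys} → xs ↭ ys → dec xs ≡ dec ys
dec-↭ {xs} {ys} xs↭ys =
  cong reverse (Pointwise-≡⇒≡ (Sorted.↗↭↗⇒≋ ℤ.≤-totalOrder (sort-↗ xs) (sort-↗ ys) sorted↭))
  where
  open SortZ using (sort-↗; sort-↭)
  sorted↭ = ↭⇒↭ₛ (↭-trans (sort-↭ xs) (↭-trans xs↭ys (↭-sym (sort-↭ ys))))

IsPermOf⇒Unique : ∀ {ℓ σ} → IsPermOf ℓ σ → Unique σ
IsPermOf⇒Unique {ℓ} σ↭ =
  Perm.Unique-resp-↭ (setoid ℕ) (↭⇒↭ₛ (↭-sym σ↭)) (Unique.map⁺ suc-injective (Unique.upTo⁺ ℓ))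

IsPermOf-length : ∀ {ℓ σ} → IsPermOf ℓ σ → length σ ≡ ℓ
IsPermOf-length {ℓ} perm = trans (↭-length perm) (trans (length-map suc (upTo ℓ)) (length-upTo ℓ))

Unique-mid : ∀ (xs : List A) {x y ys} → Unique (xs ++ x ∷ y ∷ ys) → x ≢ y
Unique-mid []       ((x≢y ∷ _) ∷ _) = x≢y
Unique-mid (_ ∷ xs) (_ ∷ u)         = Unique-mid xs u

inversions-swap : ∀ xs {x y ys} → x < y →
  inversions (xs ++ y ∷ x ∷ ys) ≡ suc (inversions (xs ++ x ∷ y ∷ ys))
inversions-swap [] {x} {y} {ys} x<y = begin
  length (filterᵇ (_<ᵇ y) (x ∷ ys)) + (below x + inversions ys)
    ≡⟨ cong (λ l → length l + _) (filter-accept (T? ∘ (_<ᵇ y)) (<⇒<ᵇ x<y)) ⟩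
  suc (below y + (below x + inversions ys))
    ≡⟨ cong suc (x∙yz≈y∙xz +-commutativeSemigroup (below y) (below x) (inversions ys)) ⟩
  suc (below x + (below y + inversions ys))
    ≡⟨ cong (λ l → suc (length l + _)) (filter-reject (T? ∘ (_<ᵇ x)) (<⇒≯ x<y ∘ <ᵇ⇒< y x)) ⟨
  suc (length (filterᵇ (_<ᵇ x) (y ∷ ys)) + (below y + inversions ys))
    ∎
  where
  open ≡-Reasoning
  below : ℕ → ℕ
  below z = length (filterᵇ (_<ᵇ z) ys)
inversions-swap (z ∷ xs) x<y = trans
  (cong₂ _+_ (↭-length (filter-↭ (T? ∘ (_<ᵇ z)) (swap-mid-↭ xs))) (inversions-swap xs x<y))
  (+-suc _ _)

sgn-swap : ∀ xs {x y ys} → x ≢ y → sgn (xs ++ y ∷ x ∷ ys) ≡ - sgn (xs ++ x ∷ y ∷ ys)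
sgn-swap xs {x} {y} {ys} x≢y with <-cmp x y
... | tri< x<y _ _ rewrite inversions-swap xs {ys = ys} x<y = ℤ.-1*i≡-i _
... | tri≈ _ x≡y _ = ⊥-elim (x≢y x≡y)
... | tri> _ _ y<x rewrite inversions-swap xs {ys = ys} y<x =
  trans (sym (ℤ.neg-involutive _)) (cong -_ (sym (ℤ.-1*i≡-i _)))

Δ-entry-shift : ∀ g s k → + g ℤ.+ + s ℤ.- + k ≡ + suc g ℤ.+ + s ℤ.- + suc k
Δ-entry-shift g s k =
  solve 3 (λ g s k → g :+ s :- k := (con ℤ.1ℤ :+ g) :+ s :- (con ℤ.1ℤ :+ k)) refl (+ g) (+ s) (+ k)
  where open +-*-Solver

-- A row moving one place down and growing by one cell, or up and shrinking by one, keeps its Δ-entry.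
Δ-swap : ∀ k (gs ss : List ℕ) {g h s₁ s₂ gs′ ss′} → length gs ≡ length ss →
  ΔFrom k (gs ++ g ∷ suc h ∷ gs′) (ss ++ s₂ ∷ s₁ ∷ ss′) ↭
  ΔFrom k (gs ++ h ∷ suc g ∷ gs′) (ss ++ s₁ ∷ s₂ ∷ ss′)
Δ-swap k [] [] {g} {h} {s₁} {s₂} refl
  rewrite Δ-entry-shift g s₂ k | Δ-entry-shift h s₁ k = swap _ _ refl
Δ-swap k (_ ∷ gs) (_ ∷ ss) eq = prep _ (Δ-swap (suc k) gs ss (suc-injective eq))

-- The row exchange of θ

module _ (c : ℕ) (a b : List ℕ) where

  swapRows-↭ : proj₁ (swapRows c a b) ++ proj₂ (swapRows c a b) ↭ a ++ b
  swapRows-↭ = begin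
    (A₁ ++ B₂) ++ B₁ ++ A₂  ≡⟨ ++-assoc A₁ B₂ _ ⟩
    A₁ ++ B₂ ++ B₁ ++ A₂    ↭⟨ ++⁺ˡ A₁ (++-comm B₂ (B₁ ++ A₂)) ⟩
    A₁ ++ (B₁ ++ A₂) ++ B₂  ≡⟨ cong (A₁ ++_) (++-assoc B₁ A₂ B₂) ⟩
    A₁ ++ B₁ ++ A₂ ++ B₂    ↭⟨ ++⁺ˡ A₁ (shifts B₁ A₂) ⟩
    A₁ ++ A₂ ++ B₁ ++ B₂    ≡⟨ ++-assoc A₁ A₂ _ ⟨
    (A₁ ++ A₂) ++ B₁ ++ B₂  ≡⟨ cong₂ _++_ (take++drop≡id c a) (take++drop≡id (suc c) b) ⟩
    a ++ b                  ∎
    where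
    open PermutationReasoning
    A₁ = take c a
    A₂ = drop c a
    B₁ = take (suc c) b
    B₂ = drop (suc c) b

  module _ (c≤∣a∣ : c ≤ length a) (c<∣b∣ : c < length b) where

    swapRows-length₁ : length b ≡ suc (length (proj₁ (swapRows c a b)))
    swapRows-length₁ = begin
      length b                                           ≡⟨ m+[n∸m]≡n c<∣b∣ ⟨
      suc c + (length b ∸ suc c)                         ≡⟨ cong₂ (λ m n → suc (m + n))
                                                              (length-take-≤ a c≤∣a∣) (length-drop (suc c) b) ⟨
      suc (length (take c a) + length (drop (suc c) b))  ≡⟨ cong suc (length-++ (take c a)) ⟨
      suc (length (take c a ++ drop (suc c) b))          ∎
      where open ≡-Reasoning

    swapRows-length₂ : length (proj₂ (swapRows c a b)) ≡ suc (length a)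
    swapRows-length₂ = begin
      length (take (suc c) b ++ drop c a)          ≡⟨ length-++ (take (suc c) b) ⟩
      length (take (suc c) b) + length (drop c a)  ≡⟨ cong₂ _+_ (length-take-≤ b c<∣b∣) (length-drop c a) ⟩
      suc c + (length a ∸ c)                       ≡⟨ cong suc (m+[n∸m]≡n c≤∣a∣) ⟩
      suc (length a)                               ∎
      where open ≡-Reasoning

    swapRows-involutive : swapRows c (proj₁ (swapRows c a b)) (proj₂ (swapRows c a b)) ≡ (a , b)
    swapRows-involutive = cong₂ _,_
      (trans (cong₂ _++_ (take-++ (take c a) ∣A₁∣) (drop-++ (take (suc c) b) ∣B₁∣)) (take++drop≡id c a))
      (trans (cong₂ _++_ (take-++ (take (suc c) b) ∣B₁∣) (drop-++ (take c a) ∣A₁∣)) (take++drop≡id (suc c) b))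
      where
      ∣A₁∣ = length-take-≤ a c≤∣a∣
      ∣B₁∣ = length-take-≤ b c<∣b∣

badEntries : Maybe ℕ → Maybe ℕ → Bool
badEntries nothing  _        = false
badEntries (just _) nothing  = true
badEntries (just y) (just x) = y ≤ᵇ x

isBad-suc : ∀ U r c → isBad U (suc r) c ≡ badEntries (entry U (suc r) c) (entry U r c)
isBad-suc U r c with entry U (suc r) c | entry U r c
... | nothing | _       = refl
... | just _  | nothing = refl
... | just _  | just _  = refl

badEntries-true⇒just : ∀ m {n} → badEntries m n ≡ true → ∃ λ y → m ≡ just y
badEntries-true⇒just (just y) _ = y , refl

badEntries-true⇒Connected : ∀ m n → badEntries m n ≡ true → Connected _≤_ m n
badEntries-true⇒Connected (just y) nothing  _   = just-nothing
badEntries-true⇒Connected (just y) (just x) y≤x = just (≤ᵇ⇒≤ y x (Equivalence.from T-≡ y≤x))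

Connected⇒badEntries-true : ∀ {y n} → Connected _≤_ (just y) n → badEntries (just y) n ≡ true
Connected⇒badEntries-true just-nothing = refl
Connected⇒badEntries-true (just y≤x)   = Equivalence.to T-≡ (≤⇒≤ᵇ y≤x)

badEntries-false : ∀ {y} n → badEntries (just y) n ≡ false → ∃ λ x → n ≡ just x × x < y
badEntries-false {y} (just x) y≰x = x , refl , ≰⇒> (λ y≤x → subst T y≰x (≤⇒≤ᵇ y≤x))

badEntries-< : ∀ {x y} → x < y → badEntries (just y) (just x) ≡ false
badEntries-< x<y = ¬-not (λ y≤x → <⇒≱ x<y (≤ᵇ⇒≤ _ _ (Equivalence.from T-≡ y≤x)))

entry-≡ : ∀ U r c → entry U r c ≡ (lookupM U r >>= λ row → lookupM row c)
entry-≡ U r c with lookupM U r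
... | nothing = refl
... | just _  = refl

entry-row : ∀ U {r row} c → lookupM U r ≡ just row → entry U r c ≡ lookupM row c
entry-row U {r} c row-r = trans (entry-≡ U r c) (cong (_>>= λ row → lookupM row c) row-r)

entry-just : ∀ U {r c y} → entry U r c ≡ just y →
  ∃ λ row → lookupM U r ≡ just row × lookupM row c ≡ just y
entry-just U {r} {c} eq with lookupM U r in row-r | entry-≡ U r c
... | just row | entry≡ = row , refl , trans (sym entry≡) eq
... | nothing  | entry≡ with () ← trans (sym entry≡) eq

isBad-rows : ∀ U {r above below} c → lookupM U r ≡ just above → lookupM U (suc r) ≡ just below →
  isBad U (suc r) c ≡ badEntries (lookupM below c) (lookupM above c)
isBad-rows U {r} c above-row below-row =
  trans (isBad-suc U r c) (cong₂ badEntries (entry-row U c below-row) (entry-row U c above-row))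

isBad-no-row : ∀ U {r} c → lookupM U (suc r) ≡ nothing → isBad U (suc r) c ≡ false
isBad-no-row U {r} c no-row = trans (isBad-suc U r c) (cong (λ m → badEntries m (entry U r c)) no-entry)
  where
  no-entry : entry U (suc r) c ≡ nothing
  no-entry = trans (entry-≡ U (suc r) c) (cong (_>>= _) no-row)

isBad-cong : ∀ U U′ r c → (∀ {i} → r ≤ suc i → entry U′ i c ≡ entry U i c) →
  isBad U′ r c ≡ isBad U r c
isBad-cong U U′ zero    c _     = refl
isBad-cong U U′ (suc r) c agree = begin
  isBad U′ (suc r) c                              ≡⟨ isBad-suc U′ r c ⟩
  badEntries (entry U′ (suc r) c) (entry U′ r c)  ≡⟨ cong₂ badEntries (agree (n≤1+n _)) (agree ≤-refl) ⟩
  badEntries (entry U (suc r) c) (entry U r c)    ≡⟨ isBad-suc U r c ⟨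
  isBad U (suc r) c                               ∎
  where open ≡-Reasoning

notBad⇒entryAbove< : ∀ U {r above below c y} → lookupM U r ≡ just above → lookupM U (suc r) ≡ just below →
  lookupM below c ≡ just y → isBad U (suc r) c ≡ false → ∃ λ x → lookupM above c ≡ just x × x < y
notBad⇒entryAbove< U {r} {above} {below} {c} {y} above-row below-row y-at good = badEntries-false _ (begin
  badEntries (just y) (lookupM above c)            ≡⟨ cong (λ m → badEntries m _) y-at ⟨
  badEntries (lookupM below c) (lookupM above c)   ≡⟨ isBad-rows U c above-row below-row ⟨
  isBad U (suc r) c                                ≡⟨ good ⟩
  false                                            ∎)
  where open ≡-Reasoning

row≤maxRowLength : ∀ U {i row} → lookupM U i ≡ just row → length row ≤ maxRowLength U
row≤maxRowLength (_ ∷ U) {zero}  refl = m≤m⊔n _ _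
row≤maxRowLength (_ ∷ U) {suc i} eq   = ≤-trans (row≤maxRowLength U eq) (m≤n⊔m _ _)

isBad-bounded : ∀ U {r c} → isBad U r c ≡ true → r < length U × c < maxRowLength U
isBad-bounded U {suc r} {c} bad
  with entry-just U (proj₂ (badEntries-true⇒just _ (trans (sym (isBad-suc U r c)) bad)))
... | row , row-at , y-at =
  lookupM-just⇒< U row-at , <-≤-trans (lookupM-just⇒< row y-at) (row≤maxRowLength U row-at)

-- Locating the first bad cell

lastBelow : (ℕ → Bool) → ℕ → Maybe ℕ
lastBelow P L = last (filterᵇ P (upTo L))

lastBelow-suc : ∀ P L → lastBelow P (suc L) ≡ (if P L then just L else lastBelow P L)
lastBelow-suc P L = begin
  last (filterᵇ P (upTo (suc L)))               ≡⟨ cong (last ∘ filterᵇ P) (upTo-∷ʳ L) ⟨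
  last (filterᵇ P (upTo L ∷ʳ L))                ≡⟨ cong last (filter-++ (T? ∘ P) (upTo L) [ L ]) ⟩
  last (filterᵇ P (upTo L) ++ filterᵇ P [ L ])  ≡⟨ last-filter-snoc ⟩
  (if P L then just L else lastBelow P L)       ∎
  where
  open ≡-Reasoning
  last-filter-snoc : last (filterᵇ P (upTo L) ++ filterᵇ P [ L ]) ≡
                     (if P L then just L else lastBelow P L)
  last-filter-snoc with P L
  ... | true  = last-∷ʳ (filterᵇ P (upTo L)) L
  ... | false = cong last (++-identityʳ (filterᵇ P (upTo L)))

lastBelow-nothing : ∀ P L → lastBelow P L ≡ nothing → ∀ {r} → r < L → P r ≡ false
lastBelow-nothing P (suc L) none {r} r<1+L with P L in PL | trans (sym (lastBelow-suc P L)) none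
... | false | none′ with m<1+n⇒m<n∨m≡n r<1+L
...   | inj₁ r<L  = lastBelow-nothing P L none′ r<L
...   | inj₂ refl = PL

record Greatest (P : ℕ → Bool) (L r : ℕ) : Set where
  field
    holds    : P r ≡ true
    bounded  : r < L
    greatest : ∀ {r′} → r < r′ → r′ < L → P r′ ≡ false

lastBelow-just : ∀ P L {r} → lastBelow P L ≡ just r → Greatest P L r
lastBelow-just P (suc L) found with P L in PL | trans (sym (lastBelow-suc P L)) found
... | true  | refl = record
  { holds    = PL
  ; bounded  = ≤-refl
  ; greatest = λ L<r′ r′<1+L → ⊥-elim (<⇒≱ L<r′ (≤-pred r′<1+L))
  }
... | false | found′ = record
  { holds    = holds
  ; bounded  = m<n⇒m<1+n bounded
  ; greatest = greatest′
  }
  where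
  open Greatest (lastBelow-just P L found′)
  greatest′ : ∀ {r′} → _ < r′ → r′ < suc L → P r′ ≡ false
  greatest′ r<r′ r′<1+L with m<1+n⇒m<n∨m≡n r′<1+L
  ... | inj₁ r′<L = greatest r<r′ r′<L
  ... | inj₂ refl = PL

findFrom-++ : ∀ U xs ys → findFrom U (xs ++ ys) ≡ (findFrom U xs <∣> findFrom U ys)
findFrom-++ U []       ys = refl
findFrom-++ U (c ∷ xs) ys with last (badRows U c)
... | just _  = refl
... | nothing = findFrom-++ U xs ys

findFrom-upTo-suc : ∀ U m →
  findFrom U (upTo (suc m)) ≡ (findFrom U (upTo m) <∣> Maybe.map (m ,_) (last (badRows U m)))
findFrom-upTo-suc U m = begin
  findFrom U (upTo (suc m))                    ≡⟨ cong (findFrom U) (upTo-∷ʳ m) ⟨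
  findFrom U (upTo m ∷ʳ m)                     ≡⟨ findFrom-++ U (upTo m) [ m ] ⟩
  (findFrom U (upTo m) <∣> findFrom U [ m ])  ≡⟨ cong (findFrom U (upTo m) <∣>_) single ⟩
  (findFrom U (upTo m) <∣> Maybe.map (m ,_) (last (badRows U m))) ∎
  where
  open ≡-Reasoning
  single : findFrom U [ m ] ≡ Maybe.map (m ,_) (last (badRows U m))
  single with last (badRows U m)
  ... | just _  = refl
  ... | nothing = refl

findFrom-upTo-nothing : ∀ U m → findFrom U (upTo m) ≡ nothing →
  ∀ {c} → c < m → last (badRows U c) ≡ nothing
findFrom-upTo-nothing U (suc m) none c<1+m
  with findFrom U (upTo m) in earlier | last (badRows U m) in here | trans (sym (findFrom-upTo-suc U m)) none
... | nothing | nothing | _ with m<1+n⇒m<n∨m≡n c<1+m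
...   | inj₁ c<m  = findFrom-upTo-nothing U m earlier c<m
...   | inj₂ refl = here

findFrom-upTo-just : ∀ U m {c r} → findFrom U (upTo m) ≡ just (c , r) →
  last (badRows U c) ≡ just r × (∀ {c′} → c′ < c → last (badRows U c′) ≡ nothing)
findFrom-upTo-just U (suc m) found
  with findFrom U (upTo m) in earlier | last (badRows U m) in here | trans (sym (findFrom-upTo-suc U m)) found
... | just _  | _      | refl = findFrom-upTo-just U m earlier
... | nothing | just _ | refl = here , findFrom-upTo-nothing U m earlier

record FirstBad (U : List (List ℕ)) (c r : ℕ) : Set where
  field
    bad        : isBad U r c ≡ true
    left-good  : ∀ {c′} → c′ < c → ∀ r′ → isBad U r′ c′ ≡ false
    below-good : ∀ {r′} → r < r′ → isBad U r′ c ≡ false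

isBad-false-inside : ∀ U r c → (r < length U → c < maxRowLength U → isBad U r c ≡ false) →
  isBad U r c ≡ false
isBad-false-inside U r c inside = ¬-not λ bad → not-¬ bad (uncurry inside (isBad-bounded U bad))

column-good : ∀ U {c} → last (badRows U c) ≡ nothing → ∀ r → isBad U r c ≡ false
column-good U {c} none r = isBad-false-inside U r c λ r<L _ → lastBelow-nothing _ (length U) none r<L

findBad-sound : ∀ U {c r} → findBad U ≡ just (c , r) → FirstBad U c r
findBad-sound U found with findFrom-upTo-just U (maxRowLength U) found
... | column , earlier = record
  { bad        = holds
  ; left-good  = λ c′<c → column-good U (earlier c′<c)
  ; below-good = λ {r′} r<r′ → isBad-false-inside U r′ _ λ r′<L _ → greatest r<r′ r′<L
  }
  where open Greatest (lastBelow-just _ (length U) column)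

findBad-nothing : ∀ U → findBad U ≡ nothing → ∀ r c → isBad U r c ≡ false
findBad-nothing U none r c =
  isBad-false-inside U r c λ _ c<M → column-good U (findFrom-upTo-nothing U (maxRowLength U) none c<M) r

FirstBad-unique : ∀ {U c r c′ r′} → FirstBad U c r → FirstBad U c′ r′ → c ≡ c′ × r ≡ r′
FirstBad-unique {c = c} {r} {c′} {r′} first first′ with <-cmp c c′
... | tri< c<c′ _ _ = ⊥-elim (not-¬ (FirstBad.bad first) (FirstBad.left-good first′ c<c′ r))
... | tri> _ _ c′<c = ⊥-elim (not-¬ (FirstBad.bad first′) (FirstBad.left-good first c′<c r′))
... | tri≈ _ refl _ with <-cmp r r′
...   | tri< r<r′ _ _ = ⊥-elim (not-¬ (FirstBad.bad first′) (FirstBad.below-good first r<r′))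
...   | tri> _ _ r′<r = ⊥-elim (not-¬ (FirstBad.bad first) (FirstBad.below-good first′ r′<r))
...   | tri≈ _ refl _ = refl , refl

findBad-complete : ∀ U {c r} → FirstBad U c r → findBad U ≡ just (c , r)
findBad-complete U {c} {r} first with findBad U in found
... | nothing = ⊥-elim (not-¬ (FirstBad.bad first) (findBad-nothing U found r c))
... | just (c′ , r′) with FirstBad-unique first (findBad-sound U found)
...   | refl , refl = refl

-- Semistandard tableaux as immaculate tableaux without bad cells

lookupM-shape : ∀ U {r row} → lookupM U r ≡ just row → lookupM (shape U) r ≡ just (length row)
lookupM-shape U row-r = trans (lookupM-map length U) (cong (Maybe.map length) row-r)

isBad-false-byRows : ∀ U r c →
  (∀ {above below} → lookupM U r ≡ just above → lookupM U (suc r) ≡ just below →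
     badEntries (lookupM below c) (lookupM above c) ≡ false) →
  isBad U (suc r) c ≡ false
isBad-false-byRows U r c good = byRow (lookupM U (suc r)) refl
  where
  byRow : ∀ m → lookupM U (suc r) ≡ m → isBad U (suc r) c ≡ false
  byRow nothing      no-row    = isBad-no-row U c no-row
  byRow (just below) below-row =
    let _ , above-row = lookupM-pred U below-row
    in trans (isBad-rows U c above-row below-row) (good above-row below-row)

SSYT⇒noBad : ∀ U → IsSSYT U → ∀ r c → isBad U r c ≡ false
SSYT⇒noBad U _                      zero    c = refl
SSYT⇒noBad U (_ , shape≥ , columns<) (suc r) c = isBad-false-byRows U r c good
  where
  good : ∀ {above below} → lookupM U r ≡ just above → lookupM U (suc r) ≡ just below →
    badEntries (lookupM below c) (lookupM above c) ≡ false
  good {above} {below} above-row below-row with lookupM below c in y-at | lookupM above c in x-at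
  ... | nothing | _      = refl
  ... | just y  | just x =
    badEntries-< (columns< r c x y (trans (entry-row U c above-row) x-at) (trans (entry-row U c below-row) y-at))
  ... | just y  | nothing = ⊥-elim (<⇒≱ (lookupM-just⇒< below y-at) (begin
    length below  ≤⟨ Linked-lookupM shape≥ (lookupM-shape U above-row) (lookupM-shape U below-row) ⟩
    length above  ≤⟨ lookupM-nothing⇒≥ above x-at ⟩
    c             ∎))
    where open ≤-Reasoning

noBad⇒SSYT : ∀ U → IsImmaculate U → (∀ r c → isBad U r c ≡ false) → IsSSYT U
noBad⇒SSYT U imm noBad = imm , Linked.map⁺ (Linked-fromLookupM U above-longer) , columns<
  where
  above-longer : ∀ {r above below} → lookupM U r ≡ just above → lookupM U (suc r) ≡ just below →
    length above ≥ length below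
  above-longer {r} {above} {below} above-row below-row = ≮⇒≥ λ ∣above∣<∣below∣ →
    let _ , y-at = lookupM-< below ∣above∣<∣below∣
        _ , x-at , _ = notBad⇒entryAbove< U above-row below-row y-at (noBad (suc r) (length above))
    in <-irrefl refl (lookupM-just⇒< above x-at)
  columns< : ∀ r c x y → entry U r c ≡ just x → entry U (suc r) c ≡ just y → x < y
  columns< r c x y x-at y-at with badEntries-false (just x)
    (trans (cong₂ badEntries (sym y-at) (sym x-at)) (trans (sym (isBad-suc U r c)) (noBad (suc r) c)))
  ... | _ , refl , x<y = x<y

lookupM-heads : ∀ U {r} → All (λ row → 1 ≤ length row) U → lookupM (mapMaybe head U) r ≡ entry U r 0
lookupM-heads []                    _              = refl
lookupM-heads ([] ∷ U)              (() ∷ _)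
lookupM-heads ((_ ∷ _) ∷ U) {zero}  _              = refl
lookupM-heads ((_ ∷ _) ∷ U) {suc r} (_ ∷ nonEmpty) = lookupM-heads U nonEmpty

Linked<⇒badEntries-false : ∀ {xs} i → Linked _<_ xs →
  badEntries (lookupM xs (suc i)) (lookupM xs i) ≡ false
Linked<⇒badEntries-false {xs} i increasing = byEntry (lookupM xs (suc i)) refl
  where
  byEntry : ∀ m → lookupM xs (suc i) ≡ m → badEntries m (lookupM xs i) ≡ false
  byEntry nothing  _    = refl
  byEntry (just y) y-at =
    let _ , x-at = lookupM-pred xs y-at
    in trans (cong (badEntries (just y)) x-at) (badEntries-< (Linked-lookupM increasing x-at y-at))

firstColumn-good : ∀ U → IsImmaculate U → IsComposition (shape U) → ∀ r → isBad U r 0 ≡ false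
firstColumn-good U _                  _    zero    = refl
firstColumn-good U (_ , _ , heads<) comp (suc r) = begin
  isBad U (suc r) 0                             ≡⟨ isBad-suc U r 0 ⟩
  badEntries (entry U (suc r) 0) (entry U r 0)  ≡⟨ cong₂ badEntries heads heads ⟨
  badEntries (lookupM H (suc r)) (lookupM H r)  ≡⟨ Linked<⇒badEntries-false r heads< ⟩
  false                                         ∎
  where
  open ≡-Reasoning
  H = mapMaybe head U
  heads : ∀ {i} → lookupM H i ≡ entry U i 0
  heads = lookupM-heads U (All.map⁻ comp)

-- The exchange at the first bad cell

SignReversingInvolutionAt : List ℕ → List ℕ → Pair → Set
SignReversingInvolutionAt la mu p =
  InEminusD la mu (θ p) × θ (θ p) ≡ p × sgn (proj₂ (θ p)) ≡ - sgn (proj₂ p)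

θ-at : ∀ {U σ c r} → findBad U ≡ just (c , suc r) →
  θ (U , σ) ≡ (adj r (swapRows c) U , adj r (λ x y → (y , x)) σ)
θ-at found rewrite found = refl

module Exchange
  {pre : List (List ℕ)} {a b : List ℕ} {post : List (List ℕ)} {c₀ : ℕ}
  {spre : List ℕ} {s₁ s₂ : ℕ} {ss : List ℕ}
  (aligned : length spre ≡ length pre)
  (imm : IsImmaculate (pre ++ a ∷ b ∷ post))
  (first : FirstBad (pre ++ a ∷ b ∷ post) (suc c₀) (suc (length pre)))
  where

  open FirstBad first

  private
    c  = suc c₀
    r  = length pre
    U  = pre ++ a ∷ b ∷ post
    a′ = proj₁ (swapRows c a b)
    b′ = proj₂ (swapRows c a b)
    U′ = pre ++ a′ ∷ b′ ∷ post
    σ  = spre ++ s₁ ∷ s₂ ∷ ss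
    σ′ = spre ++ s₂ ∷ s₁ ∷ ss

    a-sorted = proj₁ (All-mid⁻ pre (proj₁ (proj₂ imm)))
    b-sorted = proj₂ (All-mid⁻ pre (proj₁ (proj₂ imm)))
    a-pos    = proj₁ (All-mid⁻ pre (proj₁ imm))
    b-pos    = proj₂ (All-mid⁻ pre (proj₁ imm))

  isBad-between : ∀ {x y} j →
    isBad (pre ++ x ∷ y ∷ post) (suc r) j ≡ badEntries (lookupM y j) (lookupM x j)
  isBad-between {x} {y} j = isBad-rows (pre ++ x ∷ y ∷ post) j (lookupM-mid₀ pre) (lookupM-mid₁ pre)

  bad-between : badEntries (lookupM b c) (lookupM a c) ≡ true
  bad-between = trans (sym (isBad-between c)) bad

  y : ℕ
  y = proj₁ (badEntries-true⇒just (lookupM b c) bad-between)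

  y-at : lookupM b c ≡ just y
  y-at = proj₂ (badEntries-true⇒just (lookupM b c) bad-between)

  c<∣b∣ : c < length b
  c<∣b∣ = lookupM-just⇒< b y-at

  below-left : ∀ {j z} → j < c → lookupM b j ≡ just z → ∃ λ x → lookupM a j ≡ just x × x < z
  below-left j<c z-at =
    notBad⇒entryAbove< U (lookupM-mid₀ pre) (lookupM-mid₁ pre) z-at (left-good j<c (suc r))

  c≤∣a∣ : c ≤ length a
  c≤∣a∣ = ≮⇒≥ λ ∣a∣<c →
    let _ , x-at , _ = below-left ∣a∣<c (proj₂ (lookupM-< b (<-trans ∣a∣<c c<∣b∣)))
    in <-irrefl refl (lookupM-just⇒< a x-at)

  a′-sorted : Linked _≤_ a′
  a′-sorted = Linked.++⁺ (Linked-take c a-sorted) junction (Linked-drop (suc c) b-sorted)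
    where
    q-at = proj₂ (lookupM-< b (<-trans (n<1+n c₀) c<∣b∣))
    p-at = proj₁ (proj₂ (below-left (n<1+n c₀) q-at))
    p<q  = proj₂ (proj₂ (below-left (n<1+n c₀) q-at))
    junction : Connected _≤_ (last (take c a)) (head (drop (suc c) b))
    junction = subst₂ (Connected _≤_) (trans (sym p-at) (sym (last-take c₀ a c≤∣a∣))) (sym (head-drop (suc c) b))
      (Connected-just (lookupM b (suc c)) λ w-at → begin
        _  <⟨ p<q ⟩
        _  ≤⟨ Linked-lookupM b-sorted q-at y-at ⟩
        y  ≤⟨ Linked-lookupM b-sorted y-at w-at ⟩
        _  ∎)
      where open ≤-Reasoning

  b′-sorted : Linked _≤_ b′
  b′-sorted = Linked.++⁺ (Linked-take (suc c) b-sorted) junction (Linked-drop c a-sorted)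
    where
    junction : Connected _≤_ (last (take (suc c) b)) (head (drop c a))
    junction = subst₂ (Connected _≤_) (sym (last-take c b c<∣b∣)) (sym (head-drop c a))
      (badEntries-true⇒Connected _ _ bad-between)

  heads-unchanged : mapMaybe head U′ ≡ mapMaybe head U
  heads-unchanged = cong catMaybes (map-mid head pre
    (head-take-++ c₀ a (≤-trans (s≤s z≤n) c≤∣a∣)) (head-take-++ c b (≤-trans (s≤s z≤n) c<∣b∣)))

  immaculate′ : IsImmaculate U′
  immaculate′ =
    All-mid pre (proj₁ imm) (All.++⁺ (All.take⁺ c a-pos) (All.drop⁺ (suc c) b-pos))
                            (All.++⁺ (All.take⁺ (suc c) b-pos) (All.drop⁺ c a-pos)) ,
    All-mid pre (proj₁ (proj₂ imm)) a′-sorted b′-sorted ,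
    subst (Linked _<_) (sym heads-unchanged) (proj₂ (proj₂ imm))

  entry-unchanged : ∀ {i j} → (i ≡ r → j < c) → (i ≡ suc r → j ≤ c) → entry U′ i j ≡ entry U i j
  entry-unchanged {i} {j} upper lower with i ≟ r | i ≟ suc r
  ... | yes refl | _ = begin
    entry U′ r j  ≡⟨ entry-row U′ j (lookupM-mid₀ pre) ⟩
    lookupM a′ j  ≡⟨ lookupM-take-++ a (upper refl) c≤∣a∣ ⟩
    lookupM a j   ≡⟨ entry-row U j (lookupM-mid₀ pre) ⟨
    entry U r j   ∎
    where open ≡-Reasoning
  ... | no _ | yes refl = begin
    entry U′ (suc r) j  ≡⟨ entry-row U′ j (lookupM-mid₁ pre) ⟩
    lookupM b′ j        ≡⟨ lookupM-take-++ b (s≤s (lower refl)) c<∣b∣ ⟩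
    lookupM b j         ≡⟨ entry-row U j (lookupM-mid₁ pre) ⟨
    entry U (suc r) j   ∎
    where open ≡-Reasoning
  ... | no i≢r | no i≢r+1 =
    trans (entry-≡ U′ i j) (trans (cong (_>>= _) (lookupM-mid-≢ pre i≢r i≢r+1)) (sym (entry-≡ U i j)))

  bad′ : isBad U′ (suc r) c ≡ true
  bad′ = begin
    isBad U′ (suc r) c
      ≡⟨ isBad-between c ⟩
    badEntries (lookupM b′ c) (lookupM a′ c)
      ≡⟨ cong₂ badEntries (lookupM-take-++ b ≤-refl c<∣b∣) (lookupM-take-++-length a c≤∣a∣) ⟩
    badEntries (lookupM b c) (head (drop (suc c) b))
      ≡⟨ cong₂ badEntries y-at (head-drop (suc c) b) ⟩
    badEntries (just y) (lookupM b (suc c))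
      ≡⟨ Connected⇒badEntries-true (Connected-just _ (Linked-lookupM b-sorted y-at)) ⟩
    true
      ∎
    where open ≡-Reasoning

  first′ : FirstBad U′ c (suc r)
  first′ = record
    { bad        = bad′
    ; left-good  = λ {j} j<c r′ →
        trans (isBad-cong U U′ r′ j λ _ → entry-unchanged (λ _ → j<c) (λ _ → <⇒≤ j<c)) (left-good j<c r′)
    ; below-good = λ {r′} r+1<r′ →
        trans (isBad-cong U U′ r′ c λ r′≤1+i → entry-unchanged
                (λ i≡r → ⊥-elim (<-irrefl (sym i≡r) (≤-pred (≤-trans r+1<r′ r′≤1+i)))) (λ _ → ≤-refl))
              (below-good r+1<r′)
    }

  θ-forward : θ (U , σ) ≡ (U′ , σ′)
  θ-forward = trans (θ-at (findBad-complete U first))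
    (cong₂ _,_ (adj-++ pre (swapRows c) refl) (adj-++ spre _ aligned))

  θ-backward : θ (U′ , σ′) ≡ (U , σ)
  θ-backward = trans (θ-at (findBad-complete U′ first′)) (cong₂ _,_
    (trans (adj-++ pre (swapRows c) refl)
           (cong (λ p → pre ++ proj₁ p ∷ proj₂ p ∷ post) (swapRows-involutive c a b c≤∣a∣ c<∣b∣)))
    (adj-++ spre _ aligned))

  content′ : ∀ {mu} → HasContent mu U → HasContent mu U′
  content′ has k = trans (↭-length (filter-↭ _ (concat-mid-↭ pre (swapRows-↭ c a b)))) (has k)

  Δ-↭ : Δ (shape U′) σ′ ↭ Δ (shape U) σ
  Δ-↭ rewrite map-++ length pre (a′ ∷ b′ ∷ post) | map-++ length pre (a ∷ b ∷ post)
            | swapRows-length₂ c a b c≤∣a∣ c<∣b∣ | swapRows-length₁ c a b c≤∣a∣ c<∣b∣ =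
    Δ-swap 1 (map length pre) spre (trans (length-map length pre) (sym aligned))

  thc′ : ∀ {la} → IsTHCpart la (U , σ) → IsTHCpart la (U′ , σ′)
  thc′ (comp , perm , content) =
    All.map⁺ (All-mid pre (All.map⁻ comp) ∣a′∣>0 ∣b′∣>0) ,
    subst (λ ℓ → IsPermOf ℓ σ′) (trans (length-++ pre) (sym (length-++ pre)))
      (↭-trans (swap-mid-↭ spre) perm) ,
    trans (dec-↭ (filter-↭ _ Δ-↭)) content
    where
    ∣a′∣>0 : 1 ≤ length a′
    ∣a′∣>0 = ≤-trans (s≤s z≤n) (≤-pred (subst (suc c ≤_) (swapRows-length₁ c a b c≤∣a∣ c<∣b∣) c<∣b∣))
    ∣b′∣>0 : 1 ≤ length b′
    ∣b′∣>0 = subst (1 ≤_) (sym (swapRows-length₂ c a b c≤∣a∣ c<∣b∣)) (s≤s z≤n)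

  signReversingInvolution : ∀ {la mu} → InE la mu (U , σ) → SignReversingInvolutionAt la mu (U , σ)
  signReversingInvolution (thc@(_ , perm , _) , _ , content) rewrite θ-forward | θ-backward =
    ( (thc′ thc , immaculate′ , content′ content)
    , λ (_ , ssyt , _) → not-¬ bad′ (SSYT⇒noBad U′ ssyt (suc r) c)) ,
    refl ,
    sgn-swap spre (Unique-mid spre (IsPermOf⇒Unique perm))

FirstBad⇒SignReversingInvolutionAt : ∀ {la mu U σ c r} → FirstBad U c (suc r) → InE la mu (U , σ) →
  SignReversingInvolutionAt la mu (U , σ)
FirstBad⇒SignReversingInvolutionAt {U = U} {c = zero} first ((comp , _) , imm , _) =
  ⊥-elim (not-¬ (FirstBad.bad first) (firstColumn-good U imm comp _))
FirstBad⇒SignReversingInvolutionAt {U = U} {σ} {suc c₀} {r} first inE@((_ , perm , _) , imm , _)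
  with proj₁ (isBad-bounded U (FirstBad.bad first))
... | r+1<∣U∣ with adjacentPairAt r U r+1<∣U∣
                | adjacentPairAt r σ (subst (suc r <_) (sym (IsPermOf-length perm)) r+1<∣U∣)
...   | pairAt pre a b post refl | pairAt spre s₁ s₂ ss aligned =
  Exchange.signReversingInvolution aligned imm first inE

FirstBad-exists : ∀ {la mu U σ} → InEminusD la mu (U , σ) → ∃₂ λ c r → FirstBad U c (suc r)
FirstBad-exists {U = U} ((thc , imm , content) , ∉D) with findBad U in found
... | nothing          = ⊥-elim (∉D (thc , noBad⇒SSYT U imm (findBad-nothing U found) , content))
... | just (c , zero)  = ⊥-elim (not-¬ (FirstBad.bad (findBad-sound U found)) refl)
... | just (c , suc r) = c , r , findBad-sound U found

lemma5p3 : (n : ℕ) (la mu : List ℕ) → IsPartition n la → IsPartition n mu → la ≢ mu →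
    (p : Pair) → InEminusD la mu p →
    InEminusD la mu (θ p) × θ (θ p) ≡ p × sgn (proj₂ (θ p)) ≡ - sgn (proj₂ p)
lemma5p3 _ _ _ _ _ _ (_ , _) p∈E∖D =
  let _ , _ , first = FirstBad-exists p∈E∖D in FirstBad⇒SignReversingInvolutionAt first (proj₁ p∈E∖D)
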